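{- Let $G$ be a Muller game and $\sigma$ a player. Suppose that in the trap-depth game on $G$ in which $\sigma$ goes first, $X$ is a valid first move for $\sigma$ from which $\sigma$ can guarantee a win in at most $k$ rounds, and suppose $A$ is a $\sigma$-trap of $G$ with $A\cap X\neq\emptyset$. Then there is $Y\subseteq X\cap A$ such that $Y$ is a valid first move for $\sigma$ in the trap-depth game on $G[A]$ in which $\sigma$ goes first, and from which $\sigma$ can guarantee a win in at most $k$ rounds.
   Context: A Muller game $G=(V,V_{\mathrm{red}},E,\mathcal R)$ consists of a finite directed graph $(V,E)$ in which every vertex has an outgoing edge, a set $V_{\mathrm{red}}$ of Red's vertices (the others are Blue's) and $\mathcal R\subseteq 2^V$; Red wins an infinite play iff its set of infinitely often visited vertices lies in $\mathcal R$. $\overline\sigma$ is the opponent of $\sigma$; $R_\sigma=\mathcal R$ for Red and $2^V\setminus\mathcal R$ for Blue. A $\sigma$-trap is a set $X$ in which every $\sigma$-vertex has all successors in $X$ and every $\overline\sigma$-vertex has some successor in $X$; $\mathrm{Traps}_\sigma(H)$ denotes the nonempty $\sigma$-traps of $H$; $H[X]$ is the induced game. The trap-depth game on $H$ in which $\sigma$ goes first: $H_1=H$; in round $i\ge1$, $\sigma$ picks $X_i\in\mathrm{Traps}_{\overline\sigma}(H_i)$ with $X_i\in R_\sigma$, then $\overline\sigma$ picks $Y_i\in\mathrm{Traps}_\sigma(H_i[X_i])$ with $Y_i\in R_{\overline\sigma}$, and $H_{i+1}=H_i[Y_i]$; the first player with no legal move loses. "Guarantee a win in at most $k$ rounds"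 means $\overline\sigma$ is forced to have no legal move within the first $k$ rounds. -}

module Defs where

open import Data.Nat using (ℕ; zero; suc)
open import Data.Fin using (Fin)
open import Data.Fin.Subset using (Subset; _∈_; _∉_; _⊆_; _∩_; Nonempty; ⊤)
open import Data.Bool using (Bool; true; false)
open import Data.Product using (Σ; ∃; _×_; _,_)
open import Data.Empty using (⊥)
open import Relation.Binary.PropositionalEquality using (_≡_)

data Player : Set where
  red blue : Player

opp : Player → Player
opp red  = blue
opp blue = red

-- A Muller game on the vertex set Fin n.
-- Sets of vertices are `Subset n`; 𝓡 ⊆ 2^V is given by its (Boolean)
-- characteristic function on subsets.
record MullerGame (n : ℕ) : Set where
  field
    Vred  : Subset n
    E     : Fin n → Fin n → Bool
    total : ∀ v → ∃ λ w → E v w ≡ true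
    𝓡     : Subset n → Bool

module _ {n : ℕ} (G : MullerGame n) where
  open MullerGame G

  Owns : Player → Fin n → Set
  Owns red  v = v ∈ Vred
  Owns blue v = v ∉ Vred

  InR : Player → Subset n → Set
  InR red  X = 𝓡 X ≡ true
  InR blue X = 𝓡 X ≡ false

  -- X is a σ-trap of the induced game G[S] (S the current vertex set)
  IsTrap : Player → Subset n → Subset n → Set
  IsTrap σ S X =
    X ⊆ S ×
    (∀ v → v ∈ X → Owns σ v → ∀ w → w ∈ S → E v w ≡ true → w ∈ X) ×
    (∀ v → v ∈ X → Owns (opp σ) v → ∃ λ w → w ∈ X × E v w ≡ true)

  InTraps : Player → Subset n → Subset n → Set
  InTraps σ S X = IsTrap σ S X × Nonempty X

  ValidFirst : Player → Subset n → Subset n → Set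
  ValidFirst σ S X = InTraps (opp σ) S X × InR σ X

  ValidReply : Player → Subset n → Subset n → Subset n → Set
  ValidReply σ S X Y = InTraps σ X Y × InR (opp σ) Y

  -- WinsWithin σ S X k : in the trap-depth game on G[S] with σ moving first,
  -- after σ's first move X, σ can guarantee that σ̄ has no legal move
  -- within the first k rounds.  (Next arena is H[Y] with vertex set Y.)
  WinsWithin : Player → Subset n → Subset n → ℕ → Set
  WinsWithin σ S X zero    = ⊥
  WinsWithin σ S X (suc k) =
    ∀ Y → ValidReply σ S X Y →
      Σ (Subset n) λ X′ → ValidFirst σ Y X′ × WinsWithin σ Y X′ k

-- Split on whether X ∩ A is winning for σ.  If it is, X ∩ A is itself a legal
-- first move in G[A]: it is a σ̄-trap there, and every reply to it is a σ-trap
-- of X ∩ A, hence of X, so σ's strategy after X still applies.  If it is not,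
-- X ∩ A is a legal reply of σ̄ to X (a σ-trap of G[X] won by σ̄), and σ's answer
-- X′ to it is a σ̄-trap of X ∩ A, hence of A; it wins within k − 1 ≤ k rounds.
module Submission where

open import Defs
open import Data.Nat using (ℕ; zero; suc)
open import Data.Fin.Subset using (Subset; _⊆_; _∩_; Nonempty; ⊤)
open import Data.Fin.Subset.Properties using (∩-comm; x∈p∩q⁺; p∩q⊆p; p∩q⊆q)
open import Data.Product using (Σ; _×_; _,_; proj₁)
open import Data.Sum using (_⊎_; inj₁; inj₂)
open import Data.Bool using (true; false)
open import Relation.Binary.PropositionalEquality using (_≡_; refl; sym; subst)

opp-involutive : ∀ σ → opp (opp σ) ≡ σ
opp-involutive red  = refl
opp-involutive blue = refl

module _ {n : ℕ} (G : MullerGame n) where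
  open MullerGame G

  InR-dichotomy : ∀ σ (Z : Subset n) → InR G σ Z ⊎ InR G (opp σ) Z
  InR-dichotomy red  Z with 𝓡 Z
  ... | true  = inj₁ refl
  ... | false = inj₂ refl
  InR-dichotomy blue Z with 𝓡 Z
  ... | true  = inj₂ refl
  ... | false = inj₁ refl

  IsTrap-trans : ∀ {τ S P Y} → IsTrap G τ S P → IsTrap G τ P Y → IsTrap G τ S Y
  IsTrap-trans (P⊆S , P-closed , _) (Y⊆P , Y-closed , Y-escape) =
      (λ v∈Y → P⊆S (Y⊆P v∈Y))
    , (λ v v∈Y own w w∈S e → Y-closed v v∈Y own w (P-closed v (Y⊆P v∈Y) own w w∈S e) e)
    , Y-escape

  IsTrap-∩ : ∀ {τ S P Q} → IsTrap G τ S P → IsTrap G (opp τ) S Q → IsTrap G τ Q (P ∩ Q)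
  IsTrap-∩ {P = P} {Q} (P⊆S , P-closed , P-escape) (Q⊆S , Q-closed , _) =
      p∩q⊆q P Q
    , (λ v v∈P∩Q own w w∈Q e →
         x∈p∩q⁺ (P-closed v (p∩q⊆p P Q v∈P∩Q) own w (Q⊆S w∈Q) e , w∈Q))
    , (λ v v∈P∩Q own →
         let (w , w∈P , e) = P-escape v (p∩q⊆p P Q v∈P∩Q) own
         in  w , x∈p∩q⁺ (w∈P , Q-closed v (p∩q⊆q P Q v∈P∩Q) own w (P⊆S w∈P) e) , e)

  -- Once σ has moved, the arena of the round no longer matters.
  WinsWithin-arena : ∀ {σ S T X} k → WinsWithin G σ S X k → WinsWithin G σ T X k
  WinsWithin-arena zero    ()
  WinsWithin-arena (suc k) wins = wins

  WinsWithin-suc : ∀ {σ S X} k → WinsWithin G σ S X k → WinsWithin G σ S X (suc k)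
  WinsWithin-suc zero    ()
  WinsWithin-suc (suc k) wins Y reply =
    let (X′ , valid , wins′) = wins Y reply in X′ , valid , WinsWithin-suc {S = Y} k wins′

  WinsWithin-respond : ∀ {σ S X Y} k → WinsWithin G σ S X k → ValidReply G σ S X Y →
    Σ (Subset n) λ X′ → ValidFirst G σ Y X′ × WinsWithin G σ Y X′ k
  WinsWithin-respond zero    ()
  WinsWithin-respond {Y = Y} (suc k) wins reply =
    let (X′ , valid , wins′) = wins Y reply in X′ , valid , WinsWithin-suc {S = Y} k wins′

  WinsWithin-shrink : ∀ {σ S X Z} k → (∀ Y → IsTrap G σ Z Y → IsTrap G σ X Y) →
    WinsWithin G σ S X k → WinsWithin G σ S Z k
  WinsWithin-shrink zero    _     ()
  WinsWithin-shrink (suc k) lift wins Y ((Y-trap , Y-nonempty) , Y-won) =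
    wins Y ((lift Y Y-trap , Y-nonempty) , Y-won)

mainTheorem7 : {n : ℕ} (G : MullerGame n) (σ : Player) (X A : Subset n) (k : ℕ) →
    ValidFirst G σ ⊤ X → WinsWithin G σ ⊤ X k →
    IsTrap G σ ⊤ A → Nonempty (A ∩ X) →
    Σ (Subset n) λ Y → Y ⊆ (X ∩ A) × ValidFirst G σ A Y × WinsWithin G σ A Y k
mainTheorem7 G σ X A k ((X-trap , _) , _) wins A-trap A∩X-nonempty =
  move (InR-dichotomy G σ (X ∩ A))
  where
    X∩A-nonempty : Nonempty (X ∩ A)
    X∩A-nonempty = subst Nonempty (∩-comm A X) A∩X-nonempty

    X∩A-σ̄-trap : IsTrap G (opp σ) A (X ∩ A)
    X∩A-σ̄-trap =
      IsTrap-∩ G X-trap (subst (λ τ → IsTrap G τ ⊤ A) (sym (opp-involutive σ)) A-trap)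

    X∩A-σ-trap : IsTrap G σ X (X ∩ A)
    X∩A-σ-trap = subst (IsTrap G σ X) (∩-comm A X) (IsTrap-∩ G A-trap X-trap)

    move : InR G σ (X ∩ A) ⊎ InR G (opp σ) (X ∩ A) →
      Σ (Subset _) λ Y → Y ⊆ (X ∩ A) × ValidFirst G σ A Y × WinsWithin G σ A Y k
    move (inj₁ X∩A-won) =
      X ∩ A , (λ v∈ → v∈) , ((X∩A-σ̄-trap , X∩A-nonempty) , X∩A-won)
      , WinsWithin-shrink G {S = A} k (λ _ → IsTrap-trans G X∩A-σ-trap)
          (WinsWithin-arena G {S = ⊤} {T = A} k wins)
    move (inj₂ X∩A-lost) =
      let (X′ , ((X′-trap , X′-nonempty) , X′-won) , wins′) =
            WinsWithin-respond G {S = ⊤} k wins ((X∩A-σ-trap , X∩A-nonempty) , X∩A-lost)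
      in  X′ , proj₁ X′-trap , ((IsTrap-trans G X∩A-σ̄-trap X′-trap , X′-nonempty) , X′-won)
          , WinsWithin-arena G {S = X ∩ A} {T = A} k wins′
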